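{- Let $n\ge 2$ and let $R_{n,k}$ ($0\le k\le n$) denote the effective resistance between two vertices at Hamming distance $k$ in the $n$-dimensional hypercube graph $Q_n$ (vertex set $\{0,1\}^n$, edges between vertices differing in exactly one coordinate) in which every edge is a $1$-ohm resistor. Then $R_{n,k}$ is strictly concave in $k$: for all $2\le k\le n$, $$R_{n,k} - 2R_{n,k-1} + R_{n,k-2} < 0 .$$
   Context: Effective resistance between vertices $u,v$: the potential difference between $u$ and $v$ when a unit current is injected at $u$ and extracted at $v$. $R_{n,0}=0$. -}

module Defs where

open import Data.Nat using (ℕ; zero; suc)
open import Data.Bool using (Bool; true; false; not)
import Data.Bool as B
open import Data.Fin using (Fin; zero; suc)
open import Data.Vec using (Vec; []; _∷_; lookup; _[_]%=_)
open import Data.Vec.Properties using (≡-dec)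
open import Data.Rational using (ℚ; 0ℚ; 1ℚ; _+_; _-_)
open import Data.Product using (Σ; _×_)
open import Relation.Binary.PropositionalEquality using (_≡_)
open import Relation.Nullary using (yes; no)

Vertex : ℕ → Set
Vertex n = Vec Bool n

-- the neighbour of w across coordinate i (flip the i-th bit);
-- the neighbours of w in Q_n are exactly flip i w for i : Fin n
flip : ∀ {n} → Fin n → Vertex n → Vertex n
flip i w = w [ i ]%= not

hamming : ∀ {n} → Vertex n → Vertex n → ℕ
hamming [] [] = 0
hamming (x ∷ xs) (y ∷ ys) with x B.≟ y
... | yes _ = hamming xs ys
... | no  _ = suc (hamming xs ys)

sumFin : ∀ {n} → (Fin n → ℚ) → ℚ
sumFin {zero}  f = 0ℚ
sumFin {suc n} f = f zero + sumFin (λ i → f (suc i))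

δ : ∀ {n} → Vertex n → Vertex n → ℚ
δ w u with ≡-dec B._≟_ w u
... | yes _ = 1ℚ
... | no  _ = 0ℚ

-- φ is a potential for unit current injected at u and extracted at v,
-- all edges being 1-ohm resistors (Kirchhoff's current law + Ohm's law):
-- at every vertex w the net outgoing current Σ_{x ~ w} (φ w - φ x)
-- equals the external current [w = u] - [w = v].
IsUnitPotential : ∀ {n} → Vertex n → Vertex n → (Vertex n → ℚ) → Set
IsUnitPotential {n} u v φ =
  ∀ (w : Vertex n) → sumFin (λ i → φ w - φ (flip i w)) ≡ δ w u - δ w v

IsEffRes : ∀ {n} → Vertex n → Vertex n → ℚ → Set
IsEffRes {n} u v r = Σ (Vertex n → ℚ) λ φ → IsUnitPotential u v φ × (r ≡ φ u - φ v)

-- Let T j = Σ_{i ≥ j} C(n,i) be the number of vertices at distance at least j from a vertex u,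
-- so N = T 0 = 2^n. Inject N units of current at u and extract one unit at every vertex. The
-- potential is then a function radial of the distance from u: the current feeding the T (d+1)
-- vertices beyond distance d crosses the (d+1)·C(n,d+1) edges between distances d and d+1, each
-- carrying flux d = T (d+1) / ((d+1)·C(n,d+1)). Subtracting the same potential for the source v
-- and dividing by N gives a unit u-v potential, unique up to a constant by the maximum principle,
-- so R_{n,k} = (2/N)·Σ_{d<k} flux d. Strict concavity thus amounts to flux (m+1) < flux m, which
-- by (d+1)·C(n,d+1) = (n-d)·C(n,d) reduces to the binomial tail inequality
-- (m+1)·T(m+1) ≤ (n-m)·T m.
module Submission where

open import Defs
open import Algebra.Bundles using (CommutativeRing)
open import Data.Bool using (true; false)
import Data.Bool as Bool
open import Data.Empty using (⊥-elim)
open import Data.Fin using (Fin; zero; suc)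
open import Data.Nat as ℕ using (ℕ; zero; suc; pred; _∸_; s≤s; z≤n)
import Data.Nat.Properties as ℕ
open import Data.Nat.Combinatorics using (_C_; nC1≡n; k>n⇒nCk≡0; nCk+nC[k+1]≡[n+1]C[k+1])
open import Data.Nat.Tactic.RingSolver using (solve-∀)
open import Data.Product using (Σ; ∃-syntax; _×_; _,_)
open import Data.Rational using (ℚ; 0ℚ; 1ℚ; _+_; _-_; _*_; -_; _÷_; 1/_; _<_; _≤_; NonZero; positive; nonNegative)
import Data.Rational.Properties as ℚ
open import Data.Rational.Solver using (module +-*-Solver)
open import Data.Sum using (inj₁; inj₂)
open import Data.Vec using ([]; _∷_)
open import Data.Vec.Properties using (≡-dec)
open import Relation.Binary.PropositionalEquality
open import Relation.Nullary using (yes; no)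

open import Algebra.Properties.Semiring.Mult (CommutativeRing.semiring ℚ.+-*-commutativeRing)
  using (×-homo-+; ×1-homo-*) renaming (_×_ to _×ℚ_)
open import Algebra.Properties.Group ℚ.+-0-group using (x∙y⁻¹≈ε⇒x≈y)
open +-*-Solver

fromℕ : ℕ → ℚ
fromℕ m = m ×ℚ 1ℚ

fromℕ-+ : ∀ a b → fromℕ (a ℕ.+ b) ≡ fromℕ a + fromℕ b
fromℕ-+ a b = ×-homo-+ 1ℚ a b

fromℕ-* : ∀ a b → fromℕ (a ℕ.* b) ≡ fromℕ a * fromℕ b
fromℕ-* = ×1-homo-*

fromℕ-<-suc : ∀ m → fromℕ m < fromℕ (suc m)
fromℕ-<-suc m = subst (_< 1ℚ + fromℕ m) (ℚ.+-identityˡ (fromℕ m)) (ℚ.+-monoˡ-< (fromℕ m) (ℚ.positive⁻¹ 1ℚ))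

fromℕ-nonneg : ∀ m → 0ℚ ≤ fromℕ m
fromℕ-nonneg zero    = ℚ.≤-refl
fromℕ-nonneg (suc m) = ℚ.≤-trans (fromℕ-nonneg m) (ℚ.<⇒≤ (fromℕ-<-suc m))

fromℕ-mono-≤ : ∀ {a b} → a ℕ.≤ b → fromℕ a ≤ fromℕ b
fromℕ-mono-≤ {b = b} z≤n = fromℕ-nonneg b
fromℕ-mono-≤ (s≤s a≤b) = ℚ.+-monoʳ-≤ 1ℚ (fromℕ-mono-≤ a≤b)

fromℕ-mono-< : ∀ {a b} → a ℕ.< b → fromℕ a < fromℕ b
fromℕ-mono-< {a} a<b = ℚ.<-≤-trans (fromℕ-<-suc a) (fromℕ-mono-≤ a<b)

fromℕ-suc-nonZero : ∀ m → NonZero (fromℕ (suc m))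
fromℕ-suc-nonZero m = ℚ.pos⇒nonZero (fromℕ (suc m)) {{positive (fromℕ-mono-< {0} {suc m} (s≤s z≤n))}}

-- a /ℕ 0 = 0 is a junk value.
_/ℕ_ : ℕ → ℕ → ℚ
a /ℕ zero  = 0ℚ
a /ℕ suc b = (fromℕ a ÷ fromℕ (suc b)) {{fromℕ-suc-nonZero b}}

module _ (a b : ℕ) where
  private
    q = fromℕ (suc b)
    q⁻¹ = (1/ q) {{fromℕ-suc-nonZero b}}
    open ≡-Reasoning

  *-/ℕ : fromℕ (suc b) * (a /ℕ suc b) ≡ fromℕ a
  *-/ℕ = begin
    q * (fromℕ a * q⁻¹) ≡⟨ solve 3 (λ q x r → q :* (x :* r) := x :* (q :* r)) refl q (fromℕ a) q⁻¹ ⟩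
    fromℕ a * (q * q⁻¹) ≡⟨ cong (fromℕ a *_) (ℚ.*-inverseʳ q {{fromℕ-suc-nonZero b}}) ⟩
    fromℕ a * 1ℚ        ≡⟨ ℚ.*-identityʳ (fromℕ a) ⟩
    fromℕ a             ∎

  /ℕ-unique : ∀ z → fromℕ (suc b) * z ≡ fromℕ a → a /ℕ suc b ≡ z
  /ℕ-unique z qz≡a = begin
    fromℕ a * q⁻¹ ≡⟨ cong (_* q⁻¹) qz≡a ⟨
    (q * z) * q⁻¹ ≡⟨ solve 3 (λ q z r → (q :* z) :* r := (r :* q) :* z) refl q z q⁻¹ ⟩
    (q⁻¹ * q) * z ≡⟨ cong (_* z) (ℚ.*-inverseˡ q {{fromℕ-suc-nonZero b}}) ⟩
    1ℚ * z        ≡⟨ ℚ.*-identityˡ z ⟩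
    z             ∎

  *-/ℕ-scaled : ∀ m → fromℕ (m ℕ.* suc b) * (a /ℕ suc b) ≡ fromℕ (a ℕ.* m)
  *-/ℕ-scaled m = begin
    fromℕ (m ℕ.* suc b) * (a /ℕ suc b)   ≡⟨ cong (_* (a /ℕ suc b)) (fromℕ-* m (suc b)) ⟩
    (fromℕ m * q) * (a /ℕ suc b)         ≡⟨ ℚ.*-assoc (fromℕ m) q (a /ℕ suc b) ⟩
    fromℕ m * (q * (a /ℕ suc b))         ≡⟨ cong (fromℕ m *_) *-/ℕ ⟩
    fromℕ m * fromℕ a                    ≡⟨ ℚ.*-comm (fromℕ m) (fromℕ a) ⟩
    fromℕ a * fromℕ m                    ≡⟨ fromℕ-* a m ⟨
    fromℕ (a ℕ.* m)                      ∎

/ℕ-cancelˡ : ∀ k a b → fromℕ (suc k) * (a /ℕ (suc k ℕ.* b)) ≡ a /ℕ b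
/ℕ-cancelˡ k a zero rewrite ℕ.*-zeroʳ k = ℚ.*-zeroʳ (fromℕ (suc k))
/ℕ-cancelˡ k a (suc b) = sym (/ℕ-unique a b _ (begin
  fromℕ (suc b) * (fromℕ (suc k) * w)  ≡⟨ solve 3 (λ y x w → y :* (x :* w) := (x :* y) :* w) refl (fromℕ (suc b)) (fromℕ (suc k)) w ⟩
  (fromℕ (suc k) * fromℕ (suc b)) * w  ≡⟨ cong (_* w) (fromℕ-* (suc k) (suc b)) ⟨
  fromℕ (suc k ℕ.* suc b) * w          ≡⟨ *-/ℕ a (b ℕ.+ k ℕ.* suc b) ⟩
  fromℕ a                              ∎))
  where
  open ≡-Reasoning
  w = a /ℕ (suc k ℕ.* suc b)

/ℕ-+ : ∀ {a b} → 0 ℕ.< b → (b ℕ.+ a) /ℕ b ≡ 1ℚ + a /ℕ b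
/ℕ-+ {a} {suc b} _ = /ℕ-unique (suc b ℕ.+ a) b _ (begin
  fromℕ (suc b) * (1ℚ + a /ℕ suc b)                 ≡⟨ ℚ.*-distribˡ-+ (fromℕ (suc b)) 1ℚ (a /ℕ suc b) ⟩
  fromℕ (suc b) * 1ℚ + fromℕ (suc b) * (a /ℕ suc b) ≡⟨ cong₂ _+_ (ℚ.*-identityʳ (fromℕ (suc b))) (*-/ℕ a b) ⟩
  fromℕ (suc b) + fromℕ a                           ≡⟨ fromℕ-+ (suc b) a ⟨
  fromℕ (suc b ℕ.+ a)                               ∎)
  where open ≡-Reasoning

*-1/ℕ≡1 : ∀ {b} → 0 ℕ.< b → fromℕ b * (1 /ℕ b) ≡ 1ℚ
*-1/ℕ≡1 {suc b} _ = *-/ℕ 1 b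

/ℕ-1 : ∀ a → a /ℕ 1 ≡ fromℕ a
/ℕ-1 a = /ℕ-unique a 0 (fromℕ a) (ℚ.*-identityˡ (fromℕ a))

0/ℕ : ∀ b → 0 /ℕ b ≡ 0ℚ
0/ℕ zero    = refl
0/ℕ (suc b) = ℚ.*-zeroˡ ((1/ fromℕ (suc b)) {{fromℕ-suc-nonZero b}})

/ℕ-< : ∀ {a b c d} → 0 ℕ.< b → 0 ℕ.< d → a ℕ.* d ℕ.< c ℕ.* b → a /ℕ b < c /ℕ d
/ℕ-< {a} {suc b} {c} {suc d} _ _ ad<cb =
  ℚ.*-cancelˡ-<-nonNeg r {{nonNegative (fromℕ-nonneg (suc d ℕ.* suc b))}} (begin-strict
    r * (a /ℕ suc b)                       ≡⟨ *-/ℕ-scaled a b (suc d) ⟩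
    fromℕ (a ℕ.* suc d)                    <⟨ fromℕ-mono-< ad<cb ⟩
    fromℕ (c ℕ.* suc b)                    ≡⟨ *-/ℕ-scaled c d (suc b) ⟨
    fromℕ (suc b ℕ.* suc d) * (c /ℕ suc d) ≡⟨ cong (λ x → fromℕ x * (c /ℕ suc d)) (ℕ.*-comm (suc b) (suc d)) ⟩
    r * (c /ℕ suc d)                       ∎)
  where
  open ℚ.≤-Reasoning
  r = fromℕ (suc d ℕ.* suc b)

p<q⇒p-q<0 : ∀ {p q} → p < q → p - q < 0ℚ
p<q⇒p-q<0 {p} {q} p<q = subst (p - q <_) (ℚ.+-inverseʳ q) (ℚ.+-monoˡ-< (- q) p<q)

p≤q⇒0≤q-p : ∀ {p q} → p ≤ q → 0ℚ ≤ q - p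
p≤q⇒0≤q-p {p} {q} p≤q = subst (_≤ q - p) (ℚ.+-inverseʳ p) (ℚ.+-monoˡ-≤ (- p) p≤q)

-- Binomial coefficients and their upper tails

n*nCk≡k*nCk+[k+1]*nC[k+1] : ∀ n k → n ℕ.* (n C k) ≡ k ℕ.* (n C k) ℕ.+ suc k ℕ.* (n C suc k)
n*nCk≡k*nCk+[k+1]*nC[k+1] zero    zero    = refl
n*nCk≡k*nCk+[k+1]*nC[k+1] zero    (suc k) = sym (cong₂ ℕ._+_ (ℕ.*-zeroʳ (suc k)) (ℕ.*-zeroʳ (suc (suc k))))
n*nCk≡k*nCk+[k+1]*nC[k+1] (suc n) zero    = trans (ℕ.*-identityʳ (suc n)) (sym (trans (ℕ.+-identityʳ _) (nC1≡n (suc n))))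
n*nCk≡k*nCk+[k+1]*nC[k+1] (suc n) (suc k) = begin
  suc n ℕ.* (suc n C suc k)
    ≡⟨ cong (suc n ℕ.*_) (pascal k) ⟨
  suc n ℕ.* (A ℕ.+ B)
    ≡⟨ expand n A B ⟩
  (n ℕ.* A ℕ.+ n ℕ.* B) ℕ.+ (A ℕ.+ B)
    ≡⟨ cong₂ (λ x y → (x ℕ.+ y) ℕ.+ (A ℕ.+ B)) (n*nCk≡k*nCk+[k+1]*nC[k+1] n k) (n*nCk≡k*nCk+[k+1]*nC[k+1] n (suc k)) ⟩
  ((k ℕ.* A ℕ.+ suc k ℕ.* B) ℕ.+ (suc k ℕ.* B ℕ.+ suc (suc k) ℕ.* D)) ℕ.+ (A ℕ.+ B)
    ≡⟨ regroup k A B D ⟩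
  suc k ℕ.* (A ℕ.+ B) ℕ.+ suc (suc k) ℕ.* (B ℕ.+ D)
    ≡⟨ cong₂ (λ x y → suc k ℕ.* x ℕ.+ suc (suc k) ℕ.* y) (pascal k) (pascal (suc k)) ⟩
  suc k ℕ.* (suc n C suc k) ℕ.+ suc (suc k) ℕ.* (suc n C suc (suc k)) ∎
  where
  open ≡-Reasoning
  A = n C k
  B = n C suc k
  D = n C suc (suc k)
  pascal : ∀ j → n C j ℕ.+ n C suc j ≡ suc n C suc j
  pascal = nCk+nC[k+1]≡[n+1]C[k+1] n
  expand : ∀ n a b → suc n ℕ.* (a ℕ.+ b) ≡ (n ℕ.* a ℕ.+ n ℕ.* b) ℕ.+ (a ℕ.+ b)
  expand = solve-∀
  regroup : ∀ k a b d → ((k ℕ.* a ℕ.+ suc k ℕ.* b) ℕ.+ (suc k ℕ.* b ℕ.+ suc (suc k) ℕ.* d)) ℕ.+ (a ℕ.+ b)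
                        ≡ suc k ℕ.* (a ℕ.+ b) ℕ.+ suc (suc k) ℕ.* (b ℕ.+ d)
  regroup = solve-∀

[k+1]*nC[k+1]≡e*nCk : ∀ {n k e} → k ℕ.+ e ≡ n → suc k ℕ.* (n C suc k) ≡ e ℕ.* (n C k)
[k+1]*nC[k+1]≡e*nCk {n} {k} {e} k+e≡n = sym (ℕ.+-cancelˡ-≡ (k ℕ.* (n C k)) _ _ (begin
  k ℕ.* (n C k) ℕ.+ e ℕ.* (n C k)  ≡⟨ ℕ.*-distribʳ-+ (n C k) k e ⟨
  (k ℕ.+ e) ℕ.* (n C k)            ≡⟨ cong (ℕ._* (n C k)) k+e≡n ⟩
  n ℕ.* (n C k)                    ≡⟨ n*nCk≡k*nCk+[k+1]*nC[k+1] n k ⟩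
  k ℕ.* (n C k) ℕ.+ suc k ℕ.* (n C suc k) ∎))
  where open ≡-Reasoning

k≤n⇒nCk>0 : ∀ {n k} → k ℕ.≤ n → 0 ℕ.< n C k
k≤n⇒nCk>0 {n}     {zero}  _         = s≤s z≤n
k≤n⇒nCk>0 {suc n} {suc k} (s≤s k≤n) =
  subst (0 ℕ.<_) (nCk+nC[k+1]≡[n+1]C[k+1] n k) (ℕ.<-≤-trans (k≤n⇒nCk>0 k≤n) (ℕ.m≤m+n (n C k) _))

binomialSum : ℕ → ℕ → ℕ → ℕ
binomialSum n j zero    = 0
binomialSum n j (suc w) = n C j ℕ.+ binomialSum n (suc j) w

binomialSum-extend : ∀ n j w → binomialSum n j (suc w) ≡ binomialSum n j w ℕ.+ n C (j ℕ.+ w)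
binomialSum-extend n j zero = trans (ℕ.+-identityʳ (n C j)) (cong (n C_) (sym (ℕ.+-identityʳ j)))
binomialSum-extend n j (suc w) = begin
  n C j ℕ.+ binomialSum n (suc j) (suc w)                     ≡⟨ cong (n C j ℕ.+_) (binomialSum-extend n (suc j) w) ⟩
  n C j ℕ.+ (binomialSum n (suc j) w ℕ.+ n C (suc j ℕ.+ w))   ≡⟨ ℕ.+-assoc (n C j) _ _ ⟨
  (n C j ℕ.+ binomialSum n (suc j) w) ℕ.+ n C (suc j ℕ.+ w)   ≡⟨ cong (λ i → binomialSum n j (suc w) ℕ.+ n C i) (ℕ.+-suc j w) ⟨
  binomialSum n j (suc w) ℕ.+ n C (j ℕ.+ suc w)               ∎
  where open ≡-Reasoning

binomialSum-vanish : ∀ n j w → n ℕ.< j → binomialSum n j w ≡ 0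
binomialSum-vanish n j zero    _   = refl
binomialSum-vanish n j (suc w) n<j =
  cong₂ ℕ._+_ (k>n⇒nCk≡0 n<j) (binomialSum-vanish n (suc j) w (ℕ.m<n⇒m<1+n n<j))

-- tailSum n j = Σ_{i ≥ j} C(n,i); the terms with i > n vanish, so a window of width n + 1 suffices.
tailSum : ℕ → ℕ → ℕ
tailSum n j = binomialSum n j (suc n)

tailSum-suc : ∀ n j → tailSum n j ≡ n C j ℕ.+ tailSum n (suc j)
tailSum-suc n j = cong (n C j ℕ.+_) (sym (begin
  binomialSum n (suc j) (suc n)                 ≡⟨ binomialSum-extend n (suc j) n ⟩
  binomialSum n (suc j) n ℕ.+ n C (suc j ℕ.+ n) ≡⟨ cong (binomialSum n (suc j) n ℕ.+_) (k>n⇒nCk≡0 (s≤s (ℕ.m≤n+m n j))) ⟩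
  binomialSum n (suc j) n ℕ.+ 0                 ≡⟨ ℕ.+-identityʳ _ ⟩
  binomialSum n (suc j) n                       ∎))
  where open ≡-Reasoning

tailSum-vanish : ∀ {n j} → n ℕ.< j → tailSum n j ≡ 0
tailSum-vanish {n} {j} = binomialSum-vanish n j (suc n)

k≤n⇒tailSum>0 : ∀ {n k} → k ℕ.≤ n → 0 ℕ.< tailSum n k
k≤n⇒tailSum>0 {n} {k} k≤n =
  subst (0 ℕ.<_) (sym (tailSum-suc n k)) (ℕ.<-≤-trans (k≤n⇒nCk>0 k≤n) (ℕ.m≤m+n (n C k) _))

tailSum-ratio : ∀ {n} m q → m ℕ.+ q ≡ n → suc m ℕ.* tailSum n (suc m) ℕ.≤ q ℕ.* tailSum n m
tailSum-ratio {n} m zero m+0≡n = ℕ.≤-reflexive (begin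
  suc m ℕ.* tailSum n (suc m) ≡⟨ cong (suc m ℕ.*_) (tailSum-vanish (ℕ.≤-reflexive (cong suc n≡m))) ⟩
  suc m ℕ.* 0                 ≡⟨ ℕ.*-zeroʳ (suc m) ⟩
  0                           ∎)
  where
  open ≡-Reasoning
  n≡m = trans (sym m+0≡n) (ℕ.+-identityʳ m)
tailSum-ratio {n} m (suc q) m+1+q≡n = begin
  suc m ℕ.* T₁                                  ≡⟨ cong (suc m ℕ.*_) (tailSum-suc n (suc m)) ⟩
  suc m ℕ.* (C₁ ℕ.+ T₂)                         ≡⟨ ℕ.*-distribˡ-+ (suc m) C₁ T₂ ⟩
  suc m ℕ.* C₁ ℕ.+ suc m ℕ.* T₂                 ≤⟨ ℕ.+-monoʳ-≤ (suc m ℕ.* C₁) (ℕ.*-monoˡ-≤ T₂ (ℕ.n≤1+n (suc m))) ⟩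
  suc m ℕ.* C₁ ℕ.+ suc (suc m) ℕ.* T₂           ≤⟨ ℕ.+-monoʳ-≤ (suc m ℕ.* C₁) (tailSum-ratio (suc m) q (trans (sym (ℕ.+-suc m q)) m+1+q≡n)) ⟩
  suc m ℕ.* C₁ ℕ.+ q ℕ.* T₁                     ≤⟨ ℕ.+-monoʳ-≤ (suc m ℕ.* C₁) (ℕ.*-monoˡ-≤ T₁ (ℕ.n≤1+n q)) ⟩
  suc m ℕ.* C₁ ℕ.+ suc q ℕ.* T₁                 ≡⟨ cong (ℕ._+ suc q ℕ.* T₁) ([k+1]*nC[k+1]≡e*nCk m+1+q≡n) ⟩
  suc q ℕ.* (n C m) ℕ.+ suc q ℕ.* T₁            ≡⟨ ℕ.*-distribˡ-+ (suc q) (n C m) T₁ ⟨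
  suc q ℕ.* (n C m ℕ.+ T₁)                      ≡⟨ cong (suc q ℕ.*_) (tailSum-suc n m) ⟨
  suc q ℕ.* tailSum n m                         ∎
  where
  open ℕ.≤-Reasoning
  C₁ = n C suc m
  T₁ = tailSum n (suc m)
  T₂ = tailSum n (suc (suc m))

sumFin-cong : ∀ {n} {f g : Fin n → ℚ} → (∀ i → f i ≡ g i) → sumFin f ≡ sumFin g
sumFin-cong {zero}  f≗g = refl
sumFin-cong {suc n} f≗g = cong₂ _+_ (f≗g zero) (sumFin-cong (λ i → f≗g (suc i)))

sumFin-homo-- : ∀ {n} (f g : Fin n → ℚ) → sumFin (λ i → f i - g i) ≡ sumFin f - sumFin g
sumFin-homo-- {zero}  f g = refl
sumFin-homo-- {suc n} f g rewrite sumFin-homo-- (λ i → f (suc i)) (λ i → g (suc i)) =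
  solve 4 (λ a b c d → (a :- b) :+ (c :- d) := (a :+ c) :- (b :+ d)) refl
    (f zero) (g zero) (sumFin (λ i → f (suc i))) (sumFin (λ i → g (suc i)))

sumFin-*ˡ : ∀ {n} c (f : Fin n → ℚ) → sumFin (λ i → c * f i) ≡ c * sumFin f
sumFin-*ˡ {zero}  c f = sym (ℚ.*-zeroʳ c)
sumFin-*ˡ {suc n} c f rewrite sumFin-*ˡ c (λ i → f (suc i)) = sym (ℚ.*-distribˡ-+ c (f zero) _)

sumFin-nonneg : ∀ {n} {f : Fin n → ℚ} → (∀ i → 0ℚ ≤ f i) → 0ℚ ≤ sumFin f
sumFin-nonneg {zero}  f≥0 = ℚ.≤-refl
sumFin-nonneg {suc n} f≥0 = ℚ.+-mono-≤ (f≥0 zero) (sumFin-nonneg (λ i → f≥0 (suc i)))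

0≤p⇒0≤q⇒p+q≡0⇒p≡0 : ∀ {p q} → 0ℚ ≤ p → 0ℚ ≤ q → p + q ≡ 0ℚ → p ≡ 0ℚ
0≤p⇒0≤q⇒p+q≡0⇒p≡0 {p} {q} p≥0 q≥0 p+q≡0 =
  ℚ.≤-antisym (subst (p ≤_) p+q≡0 (subst (_≤ p + q) (ℚ.+-identityʳ p) (ℚ.+-monoʳ-≤ p q≥0))) p≥0

sumFin-nonneg≡0⇒≡0 : ∀ {n} {f : Fin n → ℚ} → (∀ i → 0ℚ ≤ f i) → sumFin f ≡ 0ℚ → ∀ i → f i ≡ 0ℚ
sumFin-nonneg≡0⇒≡0 f≥0 Σf≡0 zero =
  0≤p⇒0≤q⇒p+q≡0⇒p≡0 (f≥0 zero) (sumFin-nonneg (λ j → f≥0 (suc j))) Σf≡0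
sumFin-nonneg≡0⇒≡0 {f = f} f≥0 Σf≡0 (suc i) = sumFin-nonneg≡0⇒≡0 (λ j → f≥0 (suc j))
  (0≤p⇒0≤q⇒p+q≡0⇒p≡0 (sumFin-nonneg (λ j → f≥0 (suc j))) (f≥0 zero) (trans (ℚ.+-comm _ (f zero)) Σf≡0)) i

hamming-refl : ∀ {n} (u : Vertex n) → hamming u u ≡ 0
hamming-refl []          = refl
hamming-refl (true ∷ u)  = hamming-refl u
hamming-refl (false ∷ u) = hamming-refl u

hamming-sym : ∀ {n} (u w : Vertex n) → hamming u w ≡ hamming w u
hamming-sym []           []           = refl
hamming-sym (true ∷ u)   (true ∷ w)   = hamming-sym u w
hamming-sym (false ∷ u)  (false ∷ w)  = hamming-sym u w
hamming-sym (true ∷ u)   (false ∷ w)  = cong suc (hamming-sym u w)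
hamming-sym (false ∷ u)  (true ∷ w)   = cong suc (hamming-sym u w)

hamming≡0⇒≡ : ∀ {n} (u w : Vertex n) → hamming u w ≡ 0 → u ≡ w
hamming≡0⇒≡ []          []          _   = refl
hamming≡0⇒≡ (true ∷ u)  (true ∷ w)  d≡0 = cong (true ∷_) (hamming≡0⇒≡ u w d≡0)
hamming≡0⇒≡ (false ∷ u) (false ∷ w) d≡0 = cong (false ∷_) (hamming≡0⇒≡ u w d≡0)

hamming≡suc⇒flip : ∀ {n k} (x t : Vertex n) → hamming x t ≡ suc k → ∃[ i ] hamming (flip i x) t ≡ k
hamming≡suc⇒flip []          []          ()
hamming≡suc⇒flip (true ∷ x)  (true ∷ t)  eq with i , eq′ ← hamming≡suc⇒flip x t eq = suc i , eq′
hamming≡suc⇒flip (false ∷ x) (false ∷ t) eq with i , eq′ ← hamming≡suc⇒flip x t eq = suc i , eq′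
hamming≡suc⇒flip (true ∷ x)  (false ∷ t) eq = zero , ℕ.suc-injective eq
hamming≡suc⇒flip (false ∷ x) (true ∷ t)  eq = zero , ℕ.suc-injective eq

agreements : ∀ {n} → Vertex n → Vertex n → ℕ
agreements [] [] = 0
agreements (x ∷ xs) (y ∷ ys) with x Bool.≟ y
... | yes _ = suc (agreements xs ys)
... | no  _ = agreements xs ys

hamming+agreements≡n : ∀ {n} (u w : Vertex n) → hamming u w ℕ.+ agreements u w ≡ n
hamming+agreements≡n []          []          = refl
hamming+agreements≡n (true ∷ u)  (true ∷ w)  = trans (ℕ.+-suc _ _) (cong suc (hamming+agreements≡n u w))
hamming+agreements≡n (false ∷ u) (false ∷ w) = trans (ℕ.+-suc _ _) (cong suc (hamming+agreements≡n u w))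
hamming+agreements≡n (true ∷ u)  (false ∷ w) = cong suc (hamming+agreements≡n u w)
hamming+agreements≡n (false ∷ u) (true ∷ w)  = cong suc (hamming+agreements≡n u w)

δ₀ : ℕ → ℚ
δ₀ zero    = 1ℚ
δ₀ (suc _) = 0ℚ

δ≡δ₀∘hamming : ∀ {n} (w u : Vertex n) → δ w u ≡ δ₀ (hamming u w)
δ≡δ₀∘hamming w u with ≡-dec Bool._≟_ w u
... | yes refl rewrite hamming-refl w = refl
... | no w≢u with hamming u w in eq
...   | zero  = ⊥-elim (w≢u (sym (hamming≡0⇒≡ u w eq)))
...   | suc _ = refl

step-away : ∀ (F : ℕ → ℚ) h a {s} → s ≡ fromℕ h * (F h - F (pred h)) + fromℕ a * (F h - F (suc h)) →
       (F h - F (suc h)) + s ≡ fromℕ h * (F h - F (pred h)) + fromℕ (suc a) * (F h - F (suc h))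
step-away F h a refl = solve 5 (λ H A x p q → (x :- q) :+ (H :* (x :- p) :+ A :* (x :- q))
                                           := H :* (x :- p) :+ (con 1ℚ :+ A) :* (x :- q))
  refl (fromℕ h) (fromℕ a) (F h) (F (pred h)) (F (suc h))

-- At h = 0 the term F (suc (pred h)) is junk, but it carries the factor fromℕ 0.
step-toward : ∀ (F : ℕ → ℚ) h a {s} →
         s ≡ fromℕ h * (F (suc h) - F (suc (pred h))) + fromℕ a * (F (suc h) - F (suc (suc h))) →
         (F (suc h) - F h) + s ≡ fromℕ (suc h) * (F (suc h) - F h) + fromℕ a * (F (suc h) - F (suc (suc h)))
step-toward F zero a refl = solve 4 (λ A x y z → (y :- x) :+ (con 0ℚ :* (y :- y) :+ A :* (y :- z))
                                            := con 1ℚ :* (y :- x) :+ A :* (y :- z))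
  refl (fromℕ a) (F 0) (F 1) (F 2)
step-toward F (suc h) a refl = solve 5 (λ H A x y z → (y :- x) :+ (H :* (y :- x) :+ A :* (y :- z))
                                                 := (con 1ℚ :+ H) :* (y :- x) :+ A :* (y :- z))
  refl (fromℕ (suc h)) (fromℕ a) (F (suc h)) (F (suc (suc h))) (F (suc (suc (suc h))))

-- Each coordinate on which w agrees with u leads one step away from u, each other one a step back.
neighbourSum : ∀ {n} (u w : Vertex n) (F : ℕ → ℚ) →
  let d = hamming u w in
  sumFin (λ i → F d - F (hamming u (flip i w)))
    ≡ fromℕ d * (F d - F (pred d)) + fromℕ (agreements u w) * (F d - F (suc d))
neighbourSum []          []          F =
  solve 2 (λ x y → con 0ℚ := con 0ℚ :* (x :- x) :+ con 0ℚ :* (x :- y)) refl (F 0) (F 1)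
neighbourSum (true ∷ u)  (true ∷ w)  F = step-away F (hamming u w) (agreements u w) (neighbourSum u w F)
neighbourSum (false ∷ u) (false ∷ w) F = step-away F (hamming u w) (agreements u w) (neighbourSum u w F)
neighbourSum (true ∷ u)  (false ∷ w) F = step-toward F (hamming u w) (agreements u w) (neighbourSum u w (λ m → F (suc m)))
neighbourSum (false ∷ u) (true ∷ w)  F = step-toward F (hamming u w) (agreements u w) (neighbourSum u w (λ m → F (suc m)))

-- Uniqueness of potentials

Harmonic : ∀ {n} → (Vertex n → ℚ) → Set
Harmonic h = ∀ w → sumFin (λ i → h w - h (flip i w)) ≡ 0ℚ

IsMaximum : ∀ {n} → (Vertex n → ℚ) → Vertex n → Set
IsMaximum h x = ∀ y → h y ≤ h x

maximum : ∀ n (h : Vertex n → ℚ) → ∃[ x ] IsMaximum h x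
maximum zero    h = [] , λ { [] → ℚ.≤-refl }
maximum (suc n) h with maximum n (λ v → h (true ∷ v)) | maximum n (λ v → h (false ∷ v))
... | x₁ , max₁ | x₀ , max₀ with ℚ.≤-total (h (true ∷ x₁)) (h (false ∷ x₀))
...   | inj₁ ≤₀ = false ∷ x₀ , λ { (true ∷ y) → ℚ.≤-trans (max₁ y) ≤₀ ; (false ∷ y) → max₀ y }
...   | inj₂ ≤₁ = true ∷ x₁  , λ { (true ∷ y) → max₁ y ; (false ∷ y) → ℚ.≤-trans (max₀ y) ≤₁ }

-- At a maximum x the nonnegative differences h x - h (flip i x) sum to 0.
harmonic-maximum-flip : ∀ {n} {h : Vertex n → ℚ} {x} → Harmonic h → IsMaximum h x → ∀ i → h (flip i x) ≡ h x
harmonic-maximum-flip {h = h} {x} harmonic max i = sym (x∙y⁻¹≈ε⇒x≈y (h x) (h (flip i x))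
  (sumFin-nonneg≡0⇒≡0 (λ j → p≤q⇒0≤q-p (max (flip j x))) (harmonic x) i))

harmonic-maximum-spread : ∀ {n} {h : Vertex n → ℚ} → Harmonic h →
  ∀ k x t → hamming x t ≡ k → IsMaximum h x → h t ≡ h x
harmonic-maximum-spread {h = h} harmonic zero x t d≡0 _ = cong h (sym (hamming≡0⇒≡ x t d≡0))
harmonic-maximum-spread {h = h} harmonic (suc k) x t eq max
  with i , eq′ ← hamming≡suc⇒flip x t eq =
  trans (harmonic-maximum-spread harmonic k (flip i x) t eq′ (λ y → subst (h y ≤_) (sym hx′≡hx) (max y))) hx′≡hx
  where hx′≡hx = harmonic-maximum-flip harmonic max i

harmonic⇒constant : ∀ {n} {h : Vertex n → ℚ} → Harmonic h → ∀ s t → h s ≡ h t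
harmonic⇒constant {n} {h} harmonic s t with x , max ← maximum n h =
  trans (spread s) (sym (spread t))
  where spread = λ y → harmonic-maximum-spread harmonic _ x y refl max

unitPotential-drop-unique : ∀ {n} {u v : Vertex n} {φ ψ} →
  IsUnitPotential u v φ → IsUnitPotential u v ψ → φ u - φ v ≡ ψ u - ψ v
unitPotential-drop-unique {u = u} {v} {φ} {ψ} φ-unit ψ-unit = begin
  φ u - φ v                    ≡⟨ solve 4 (λ a b c d → a :- b := (c :- d) :+ ((a :- c) :- (b :- d))) refl (φ u) (φ v) (ψ u) (ψ v) ⟩
  (ψ u - ψ v) + (h u - h v)    ≡⟨ cong (λ x → (ψ u - ψ v) + (x - h v)) (harmonic⇒constant {h = h} h-harmonic u v) ⟩
  (ψ u - ψ v) + (h v - h v)    ≡⟨ cong ((ψ u - ψ v) +_) (ℚ.+-inverseʳ (h v)) ⟩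
  (ψ u - ψ v) + 0ℚ             ≡⟨ ℚ.+-identityʳ (ψ u - ψ v) ⟩
  ψ u - ψ v                    ∎
  where
  open ≡-Reasoning
  h = λ w → φ w - ψ w
  h-harmonic : Harmonic h
  h-harmonic w = begin
    sumFin (λ i → h w - h (flip i w))
      ≡⟨ sumFin-cong (λ i → solve 4 (λ a b c d → (a :- c) :- (b :- d) := (a :- b) :- (c :- d)) refl
                               (φ w) (φ (flip i w)) (ψ w) (ψ (flip i w))) ⟩
    sumFin (λ i → (φ w - φ (flip i w)) - (ψ w - ψ (flip i w)))
      ≡⟨ sumFin-homo-- (λ i → φ w - φ (flip i w)) (λ i → ψ w - ψ (flip i w)) ⟩
    sumFin (λ i → φ w - φ (flip i w)) - sumFin (λ i → ψ w - ψ (flip i w))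
      ≡⟨ cong₂ _-_ (φ-unit w) (ψ-unit w) ⟩
    (δ w u - δ w v) - (δ w u - δ w v)
      ≡⟨ ℚ.+-inverseʳ (δ w u - δ w v) ⟩
    0ℚ ∎

-- ψ u injects M units at u and extracts one at every vertex; the extractions cancel in ψ u - ψ v.
unitPotential-superpose : ∀ {n} (M c : ℚ) (ψ : Vertex n → Vertex n → ℚ) → c * M ≡ 1ℚ →
  (∀ u w → sumFin (λ i → ψ u w - ψ u (flip i w)) ≡ M * δ w u - 1ℚ) →
  ∀ u v → IsUnitPotential u v (λ w → (ψ u w - ψ v w) * c)
unitPotential-superpose M c ψ cM≡1 ψ-source u v w = begin
  sumFin (λ i → (ψ u w - ψ v w) * c - (ψ u (flip i w) - ψ v (flip i w)) * c)
    ≡⟨ sumFin-cong (λ i → solve 5 (λ a b a′ b′ c → (a :- b) :* c :- (a′ :- b′) :* c := c :* ((a :- a′) :- (b :- b′))) refl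
                             (ψ u w) (ψ v w) (ψ u (flip i w)) (ψ v (flip i w)) c) ⟩
  sumFin (λ i → c * ((ψ u w - ψ u (flip i w)) - (ψ v w - ψ v (flip i w))))
    ≡⟨ sumFin-*ˡ c (λ i → (ψ u w - ψ u (flip i w)) - (ψ v w - ψ v (flip i w))) ⟩
  c * sumFin (λ i → (ψ u w - ψ u (flip i w)) - (ψ v w - ψ v (flip i w)))
    ≡⟨ cong (c *_) (sumFin-homo-- (λ i → ψ u w - ψ u (flip i w)) (λ i → ψ v w - ψ v (flip i w))) ⟩
  c * (sumFin (λ i → ψ u w - ψ u (flip i w)) - sumFin (λ i → ψ v w - ψ v (flip i w)))
    ≡⟨ cong (λ x → c * x) (cong₂ _-_ (ψ-source u w) (ψ-source v w)) ⟩
  c * ((M * δ w u - 1ℚ) - (M * δ w v - 1ℚ))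
    ≡⟨ solve 4 (λ c M x y → c :* ((M :* x :- con 1ℚ) :- (M :* y :- con 1ℚ)) := (c :* M) :* (x :- y)) refl c M (δ w u) (δ w v) ⟩
  (c * M) * (δ w u - δ w v)
    ≡⟨ cong (_* (δ w u - δ w v)) cM≡1 ⟩
  1ℚ * (δ w u - δ w v)
    ≡⟨ ℚ.*-identityˡ (δ w u - δ w v) ⟩
  δ w u - δ w v ∎
  where open ≡-Reasoning

-- The resistance profile of Q_n

module Resistance (n : ℕ) where

  private
    T : ℕ → ℕ
    T = tailSum n

  N : ℕ
  N = T 0

  N>0 : 0 ℕ.< N
  N>0 = k≤n⇒tailSum>0 {n} z≤n

  flux : ℕ → ℚ
  flux d = T (suc d) /ℕ (suc d ℕ.* (n C suc d))

  radial : ℕ → ℚ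
  radial zero    = 0ℚ
  radial (suc d) = radial d - flux d

  flux-inward : ∀ d → fromℕ (suc d) * flux d ≡ T (suc d) /ℕ (n C suc d)
  flux-inward d = /ℕ-cancelˡ d (T (suc d)) (n C suc d)

  flux-outward : ∀ d e → d ℕ.+ e ≡ n → fromℕ e * flux d ≡ T (suc d) /ℕ (n C d)
  flux-outward d zero d+0≡n = begin
    0ℚ * flux d          ≡⟨ ℚ.*-zeroˡ (flux d) ⟩
    0ℚ                   ≡⟨ 0/ℕ (n C d) ⟨
    0 /ℕ (n C d)         ≡⟨ cong (_/ℕ (n C d)) (tailSum-vanish (s≤s (ℕ.≤-reflexive n≡d))) ⟨
    T (suc d) /ℕ (n C d) ∎
    where
    open ≡-Reasoning
    n≡d = trans (sym d+0≡n) (ℕ.+-identityʳ d)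
  flux-outward d (suc e) d+e≡n = begin
    fromℕ (suc e) * flux d                                ≡⟨ cong (λ x → fromℕ (suc e) * (T (suc d) /ℕ x)) ([k+1]*nC[k+1]≡e*nCk d+e≡n) ⟩
    fromℕ (suc e) * (T (suc d) /ℕ (suc e ℕ.* (n C d)))    ≡⟨ /ℕ-cancelˡ e (T (suc d)) (n C d) ⟩
    T (suc d) /ℕ (n C d)                                  ∎
    where open ≡-Reasoning

  -- Kirchhoff's law at distance d from the source: e = n - d coordinates lead outward.
  radial-kirchhoff : ∀ d e → d ℕ.+ e ≡ n →
    fromℕ d * (radial d - radial (pred d)) + fromℕ e * (radial d - radial (suc d)) ≡ fromℕ N * δ₀ d - 1ℚ
  radial-kirchhoff zero .n refl = begin
    0ℚ * (0ℚ - 0ℚ) + fromℕ n * (0ℚ - (0ℚ - flux 0))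
      ≡⟨ solve 2 (λ x f → con 0ℚ :* (con 0ℚ :- con 0ℚ) :+ x :* (con 0ℚ :- (con 0ℚ :- f)) := x :* f) refl (fromℕ n) (flux 0) ⟩
    fromℕ n * flux 0                ≡⟨ flux-outward 0 n refl ⟩
    T 1 /ℕ 1                        ≡⟨ /ℕ-1 (T 1) ⟩
    fromℕ (T 1)                     ≡⟨ solve 1 (λ t → t := (con 1ℚ :+ t) :* con 1ℚ :- con 1ℚ) refl (fromℕ (T 1)) ⟩
    fromℕ (suc (T 1)) * 1ℚ - 1ℚ     ≡⟨ cong (λ m → fromℕ m * 1ℚ - 1ℚ) (tailSum-suc n 0) ⟨
    fromℕ N * δ₀ 0 - 1ℚ             ∎
    where open ≡-Reasoning
  radial-kirchhoff (suc d) e 1+d+e≡n = begin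
    fromℕ (suc d) * ((r - flux d) - r) + fromℕ e * ((r - flux d) - ((r - flux d) - flux (suc d)))
      ≡⟨ solve 5 (λ x r f e f′ → x :* ((r :- f) :- r) :+ e :* ((r :- f) :- ((r :- f) :- f′)) := :- (x :* f) :+ e :* f′) refl
           (fromℕ (suc d)) r (flux d) (fromℕ e) (flux (suc d)) ⟩
    - (fromℕ (suc d) * flux d) + fromℕ e * flux (suc d)
      ≡⟨ cong₂ (λ x y → - x + y) (flux-inward d) (flux-outward (suc d) e 1+d+e≡n) ⟩
    - (T (suc d) /ℕ K) + T (suc (suc d)) /ℕ K
      ≡⟨ cong (λ x → - (x /ℕ K) + T (suc (suc d)) /ℕ K) (tailSum-suc n (suc d)) ⟩
    - ((K ℕ.+ T (suc (suc d))) /ℕ K) + T (suc (suc d)) /ℕ K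
      ≡⟨ cong (λ x → - x + T (suc (suc d)) /ℕ K) (/ℕ-+ (k≤n⇒nCk>0 (subst (suc d ℕ.≤_) 1+d+e≡n (ℕ.m≤m+n (suc d) e)))) ⟩
    - (1ℚ + T (suc (suc d)) /ℕ K) + T (suc (suc d)) /ℕ K
      ≡⟨ solve 2 (λ x N → :- (con 1ℚ :+ x) :+ x := N :* con 0ℚ :- con 1ℚ) refl (T (suc (suc d)) /ℕ K) (fromℕ N) ⟩
    fromℕ N * 0ℚ - 1ℚ ∎
    where
    open ≡-Reasoning
    r = radial d
    K = n C suc d

  radial-source : ∀ u w → sumFin (λ i → radial (hamming u w) - radial (hamming u (flip i w))) ≡ fromℕ N * δ w u - 1ℚ
  radial-source u w = begin
    sumFin (λ i → radial (hamming u w) - radial (hamming u (flip i w)))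
      ≡⟨ neighbourSum u w radial ⟩
    fromℕ d * (radial d - radial (pred d)) + fromℕ (agreements u w) * (radial d - radial (suc d))
      ≡⟨ radial-kirchhoff d (agreements u w) (hamming+agreements≡n u w) ⟩
    fromℕ N * δ₀ d - 1ℚ
      ≡⟨ cong (λ x → fromℕ N * x - 1ℚ) (δ≡δ₀∘hamming w u) ⟨
    fromℕ N * δ w u - 1ℚ ∎
    where
    open ≡-Reasoning
    d = hamming u w

  potential : Vertex n → Vertex n → Vertex n → ℚ
  potential u v w = (radial (hamming u w) - radial (hamming v w)) * (1 /ℕ N)

  potential-isUnitPotential : ∀ u v → IsUnitPotential u v (potential u v)
  potential-isUnitPotential = unitPotential-superpose (fromℕ N) (1 /ℕ N) (λ u w → radial (hamming u w))
    (trans (ℚ.*-comm (1 /ℕ N) (fromℕ N)) (*-1/ℕ≡1 N>0))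
    radial-source

  resistance : ℕ → ℚ
  resistance k = (- radial k - radial k) * (1 /ℕ N)

  potential-drop : ∀ u v → potential u v u - potential u v v ≡ resistance (hamming u v)
  potential-drop u v rewrite hamming-refl u | hamming-refl v | hamming-sym v u =
    solve 2 (λ r c → (con 0ℚ :- r) :* c :- (r :- con 0ℚ) :* c := (:- r :- r) :* c) refl (radial (hamming u v)) (1 /ℕ N)

  isEffRes⇒≡resistance : ∀ {u v : Vertex n} {r k} → IsEffRes u v r → hamming u v ≡ k → r ≡ resistance k
  isEffRes⇒≡resistance {u} {v} {r} {k} (φ , φ-unit , r≡drop) uv≡k = begin
    r                                 ≡⟨ r≡drop ⟩
    φ u - φ v                         ≡⟨ unitPotential-drop-unique {φ = φ} {ψ = potential u v} φ-unit (potential-isUnitPotential u v) ⟩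
    potential u v u - potential u v v ≡⟨ potential-drop u v ⟩
    resistance (hamming u v)          ≡⟨ cong resistance uv≡k ⟩
    resistance k                      ∎
    where open ≡-Reasoning

  flux-decreasing : ∀ m → 2 ℕ.+ m ℕ.≤ n → flux (suc m) < flux m
  flux-decreasing m 2+m≤n with o , 2+m+o≡n ← ℕ.m≤n⇒∃[o]m+o≡n 2+m≤n = begin-strict
    flux (suc m)            ≡⟨ cong (T₂ /ℕ_) ([k+1]*nC[k+1]≡e*nCk 1+m+1+o≡n) ⟩
    T₂ /ℕ (suc o ℕ.* K)     <⟨ /ℕ-< (ℕ.*-mono-< {0} {suc o} ℕ.z<s K>0) (ℕ.*-mono-< {0} {suc m} ℕ.z<s K>0) cross-multiplied ⟩
    T₁ /ℕ (suc m ℕ.* K)     ≡⟨⟩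
    flux m                  ∎
    where
    open ℚ.≤-Reasoning
    T₁ = T (suc m)
    T₂ = T (suc (suc m))
    K = n C suc m
    1+m+1+o≡n = trans (ℕ.+-suc (suc m) o) 2+m+o≡n
    K>0 = k≤n⇒nCk>0 (ℕ.<⇒≤ 2+m≤n)
    T₂>0 = k≤n⇒tailSum>0 2+m≤n
    rearrange : ∀ a b c → (b ℕ.* a) ℕ.* c ≡ a ℕ.* (b ℕ.* c)
    rearrange = solve-∀
    cross-multiplied : T₂ ℕ.* (suc m ℕ.* K) ℕ.< T₁ ℕ.* (suc o ℕ.* K)
    cross-multiplied = subst₂ ℕ._<_ (rearrange T₂ (suc m) K) (rearrange T₁ (suc o) K)
      (ℕ.*-monoˡ-< K {{ℕ.>-nonZero K>0}}
        (ℕ.<-≤-trans (ℕ.*-monoˡ-< T₂ {{ℕ.>-nonZero T₂>0}} (ℕ.n<1+n (suc m)))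
                     (tailSum-ratio (suc m) (suc o) 1+m+1+o≡n)))

  resistance-concave : ∀ m → 2 ℕ.+ m ℕ.≤ n →
    ((resistance (2 ℕ.+ m) - resistance (1 ℕ.+ m)) - resistance (1 ℕ.+ m)) + resistance m < 0ℚ
  resistance-concave m 2+m≤n = begin-strict
    ((resistance (2 ℕ.+ m) - resistance (1 ℕ.+ m)) - resistance (1 ℕ.+ m)) + resistance m
      ≡⟨ solve 4 (λ r f f′ c → (((:- ((r :- f) :- f′) :- ((r :- f) :- f′)) :* c :- (:- (r :- f) :- (r :- f)) :* c)
                                 :- (:- (r :- f) :- (r :- f)) :* c) :+ (:- r :- r) :* c
                               := ((f′ :- f) :+ (f′ :- f)) :* c) refl (radial m) (flux m) (flux (suc m)) (1 /ℕ N) ⟩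
    (Δf + Δf) * (1 /ℕ N)
      <⟨ ℚ.*-monoˡ-<-pos (1 /ℕ N) {{positive 1/N>0}} (ℚ.+-mono-< Δf<0 Δf<0) ⟩
    0ℚ * (1 /ℕ N)
      ≡⟨ ℚ.*-zeroˡ (1 /ℕ N) ⟩
    0ℚ ∎
    where
    open ℚ.≤-Reasoning
    Δf = flux (suc m) - flux m
    Δf<0 : Δf < 0ℚ
    Δf<0 = p<q⇒p-q<0 (flux-decreasing m 2+m≤n)
    1/N>0 : 0ℚ < 1 /ℕ N
    1/N>0 = /ℕ-< {0} {1} {1} {N} (s≤s z≤n) N>0 (s≤s z≤n)

  isEffRes-concave : ∀ m → 2 ℕ.+ m ℕ.≤ n → ∀ {a b c d e f : Vertex n} {r₀ r₁ r₂} →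
    hamming a b ≡ 2 ℕ.+ m → hamming c d ≡ 1 ℕ.+ m → hamming e f ≡ m →
    IsEffRes a b r₀ → IsEffRes c d r₁ → IsEffRes e f r₂ → ((r₀ - r₁) - r₁) + r₂ < 0ℚ
  isEffRes-concave m 2+m≤n hab hcd hef R₀ R₁ R₂ =
    subst (_< 0ℚ)
      (sym (cong₂ _+_ (cong₂ (λ x y → (x - y) - y) (isEffRes⇒≡resistance R₀ hab) (isEffRes⇒≡resistance R₁ hcd))
                      (isEffRes⇒≡resistance R₂ hef)))
      (resistance-concave m 2+m≤n)

mainTheorem10 : ∀ (n : ℕ) → 2 ℕ.≤ n →
    ((u v : Vertex n) → Σ ℚ λ r → IsEffRes u v r)
    ×
    (∀ (k : ℕ) → 2 ℕ.≤ k → k ℕ.≤ n →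
      ∀ (a b c d e f : Vertex n) →
      hamming a b ≡ k → hamming c d ≡ k ∸ 1 → hamming e f ≡ k ∸ 2 →
      ∀ (r₀ r₁ r₂ : ℚ) →
      IsEffRes a b r₀ → IsEffRes c d r₁ → IsEffRes e f r₂ →
      ((r₀ - r₁) - r₁) + r₂ < 0ℚ)
mainTheorem10 n _ =
  (λ u v → resistance (hamming u v) , potential u v , potential-isUnitPotential u v , sym (potential-drop u v)) ,
  λ { _ (s≤s (s≤s {n = m} _)) k≤n _ _ _ _ _ _ hab hcd hef _ _ _ → isEffRes-concave m k≤n hab hcd hef }
  where open Resistance n
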